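{- For all positive integers $n$ and $m$: (1) $r_{n,m}\preceq r_{n+1,m}$ and $r_{n,m}\preceq r_{n,m+1}$; (2) $c_{n,m}\preceq c_{n+1,m}$ and $c_{n,m}\preceq c_{n,m+1}$; (3) $s_{n,m}\preceq s_{n+1,m}$ and $s_{n,m}\preceq s_{n,m+1}$.
   Context: RK puzzles: for a positive integer $n$ let $I_n=\{1,\dots,n\}$ and $I_{n,m}=I_n\times I_m\subset\mathbb{R}^2$ (first coordinate horizontal). For a slope $s\in\mathbb{Q}\cup\{\infty\}$ let $\mathscr{L}_s$ be the set of lines of slope $s$ meeting $I_{n,m}$, and for $\ell\in\mathscr{L}_s$ let $P_{\ell,s}(X)=\sum_{(i,j)\in\ell\cap I_{n,m}}X_{i,j}$. An $n\times m$ RK puzzle with finite slope set $T$ is a system consisting of one equation $P_{\ell,t}(X)=c_{\ell,t}$ (arbitrary $c_{\ell,t}\in\mathbb{R}$) for each $t\in T$, $\ell\in\mathscr{L}_t$; solutions are real solutions; solvable means having a solution. An entry $X_{i,j}$ (or a set of entries) is uniquely solvable if all solutions agree on it (on each of them). Slope order: $S=\mathbb{Z}\cup\{1/k:k\in\mathbb{Z}\}$ with $1/0:=\infty$, totally ordered by $0\prec\infty\prec-1\prec1\prec-\frac12\prec-2\prec\frac12\prec2\prec-\frac13\prec-3\prec\frac13\prec3\prec\cdots$ (after $0,\infty,-1,1$, for each $k=2,3,\dots$ in turn come $-\frac1k\prec-k\prec\frac1k\prec k$). For $s\in S$, $\mathrm{RK}^s_{n,m}$ is the family of all solvable $n\times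 m$ RK puzzles with slope set $\{t\in S:t\preceq s\}$. Rows and columns: the $j$-th row of $I_{n,m}$ is $I_n\times\{j\}$, the first and last rows being $j=1$ and $j=m$; the $i$-th column is $\{i\}\times I_m$, the first and last columns being $i=1$ and $i=n$. Invariants: $r_{n,m}$ (resp. $c_{n,m}$) is the smallest $s\in S$ with respect to $\prec$ such that for every RK puzzle in $\mathrm{RK}^{s}_{n,m}$, the first row or the last row (resp. the first column or the last column) is uniquely solvable; $s_{n,m}=\min\{r_{n,m},c_{n,m}\}$ with respect to $\prec$.
   Formalization: The constants $c_{\ell,t}$ and the solution entries $X_{i,j}$ of the RK puzzles are rational rather than real. -}

module Defs where

open import Data.Nat using (ℕ; zero; suc; _≤_; _⊓_; _∸_)
open import Data.Integer as ℤ using (ℤ; +_; -_; _-_)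
open import Data.Fin using (Fin; toℕ)
open import Data.Product using (_×_; _,_; ∃; Σ)
open import Data.Sum using (_⊎_)
open import Data.Rational as ℚ using (ℚ; 0ℚ; _+_)
open import Relation.Binary.PropositionalEquality using (_≡_)
open import Relation.Nullary using (does)
open import Data.Bool using (if_then_else_)

-- The slope set S = ℤ ∪ {1/k} with the total order ≺ of the paper
--   0 ≺ ∞ ≺ -1 ≺ 1 ≺ -1/2 ≺ -2 ≺ 1/2 ≺ 2 ≺ -1/3 ≺ -3 ≺ 1/3 ≺ 3 ≺ ⋯
-- is order-isomorphic to (ℕ, ≤).  We represent a slope by its position
-- in this enumeration, so  s ⪯ t  is  s ≤ t  on ℕ, and the geometric
-- meaning of slope number s is given by its direction vector 'dir s'.

Slope : Set
Slope = ℕ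

_⪯_ : Slope → Slope → Set
s ⪯ t = s ≤ t

-- direction vector (a , b) of a slope b/a  (a = 0 means slope ∞)
-- for the block k = 2,3,…:  -1/k , -k , 1/k , k
dirBlock : ℕ → ℕ → ℤ × ℤ
dirBlock 0 k = (+ k , - (+ 1))
dirBlock 1 k = (+ 1 , - (+ k))
dirBlock 2 k = (+ k , + 1)
dirBlock 3 k = (+ 1 , + k)
dirBlock (suc (suc (suc (suc x)))) k = dirBlock x (suc k)

dir : Slope → ℤ × ℤ
dir 0 = (+ 1 , + 0)
dir 1 = (+ 0 , + 1)
dir 2 = (+ 1 , - (+ 1))
dir 3 = (+ 1 , + 1)
dir (suc (suc (suc (suc x)))) = dirBlock x 2

-- The grid I_{n,m}: cell (i , j) with i : Fin n, j : Fin m stands for the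
-- point (toℕ i + 1 , toℕ j + 1) ∈ ℝ² (first coordinate horizontal).

coord : ∀ {k} → Fin k → ℤ
coord i = + suc (toℕ i)

-- Label of the line of slope t through a cell: for direction (a , b),
-- the lines of slope t are the level sets of  b·x − a·y.
label : ∀ {n m} → Slope → Fin n → Fin m → ℤ
label t i j with dir t
... | (a , b) = (b ℤ.* coord i) - (a ℤ.* coord j)

ΣFin : ∀ k → (Fin k → ℚ) → ℚ
ΣFin zero f = 0ℚ
ΣFin (suc k) f = f Fin.zero + ΣFin k (λ i → f (Fin.suc i))

Grid : ℕ → ℕ → Set
Grid n m = Fin n → Fin m → ℚ

lineSum : ∀ {n m} → Grid n m → Slope → ℤ → ℚ
lineSum {n} {m} X t ℓ =
  ΣFin n (λ i → ΣFin m (λ j → if does (label t i j ℤ.≟ ℓ) then X i j else 0ℚ))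

-- An n×m RK puzzle with slope set {t ∈ S : t ⪯ s} is given by its
-- constants c t ℓ (one for each slope t ⪯ s and each line label ℓ; only
-- lines meeting the grid matter).
Constants : Set
Constants = Slope → ℤ → ℚ

-- X is a (real -- here rational) solution of the puzzle
IsSolution : ∀ n m → Slope → Constants → Grid n m → Set
IsSolution n m s c X =
  ∀ t → t ⪯ s → ∀ (i : Fin n) (j : Fin m) →
  lineSum X t (label t i j) ≡ c t (label t i j)

Solvable : ∀ n m → Slope → Constants → Set
Solvable n m s c = Σ (Grid n m) (IsSolution n m s c)

RowUnique : ∀ n m → Slope → Constants → ℕ → Set
RowUnique n m s c j₀ =
  ∀ X Y → IsSolution n m s c X → IsSolution n m s c Y →
  ∀ (i : Fin n) (j : Fin m) → toℕ j ≡ j₀ → X i j ≡ Y i j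

ColUnique : ∀ n m → Slope → Constants → ℕ → Set
ColUnique n m s c i₀ =
  ∀ X Y → IsSolution n m s c X → IsSolution n m s c Y →
  ∀ (i : Fin n) (j : Fin m) → toℕ i ≡ i₀ → X i j ≡ Y i j

RowProp : ℕ → ℕ → Slope → Set
RowProp n m s = ∀ c → Solvable n m s c →
  RowUnique n m s c 0 ⊎ RowUnique n m s c (m ∸ 1)

ColProp : ℕ → ℕ → Slope → Set
ColProp n m s = ∀ c → Solvable n m s c →
  ColUnique n m s c 0 ⊎ ColUnique n m s c (n ∸ 1)

IsR : ℕ → ℕ → Slope → Set
IsR n m r = RowProp n m r × (∀ t → RowProp n m t → r ⪯ t)

IsC : ℕ → ℕ → Slope → Set
IsC n m c = ColProp n m c × (∀ t → ColProp n m t → c ⪯ t)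

IsS : ℕ → ℕ → Slope → Set
IsS n m s = ∃ λ r → ∃ λ c → IsR n m r × IsC n m c × s ≡ r ⊓ c

{-# OPTIONS --safe #-}

-- Two solutions of a puzzle differ by a homogeneous grid (all line sums zero),
-- so whether a set of entries is uniquely solvable depends only on whether
-- every homogeneous grid vanishes there. Padding a homogeneous n×m grid by a
-- zero column or row, at either end, gives a homogeneous grid of the larger
-- size: the padding is a translation, which maps the lines of each slope onto
-- lines of the same slope. Hence if every puzzle on the larger grid has its
-- first or last row (column) uniquely solvable, so has every puzzle on the
-- smaller grid: every slope bound that works for the larger grid works for the
-- smaller one, so the least such bounds, and their minimum, grow with the grid.
module Submission where

open import Defs
open import Data.Nat using (ℕ; zero; suc; _≤_; _⊓_)
open import Data.Product using (_×_; _,_; proj₁; proj₂; ∃)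

open import Algebra.Bundles using (CommutativeMonoid)
open import Data.Bool using (Bool; true; false; if_then_else_)
open import Data.Fin using (Fin; zero; suc; toℕ; inject₁; fromℕ)
open import Data.Fin.Properties using (any?; toℕ-inject₁)
open import Data.Integer as ℤ using (ℤ; 1ℤ)
import Data.Integer.Properties as ℤ
open import Data.Integer.Tactic.RingSolver using (solve-∀)
open import Data.Nat.Properties using (⊓-mono-≤)
open import Data.Rational as ℚ using (ℚ; 0ℚ; _+_; _-_)
import Data.Rational.Properties as ℚ
open import Data.Sum as Sum using (inj₁)
open import Data.Vec.Functional using (Vector; _∷_; head; tail)
open import Function using (_∘_; id; mk⇔)
open import Relation.Binary.PropositionalEquality
open import Relation.Nullary using (does; yes; no)
open import Relation.Nullary.Decidable using (does-⇔; dec-false)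
open import Relation.Unary using (_⊆_)

open import Algebra.Properties.AbelianGroup ℤ.+-0-abelianGroup
  using (//-rightDividesˡ; //-rightDividesʳ)
open import Algebra.Properties.AbelianGroup ℚ.+-0-abelianGroup
  using (x∙y⁻¹≈ε⇒x≈y)
open import Algebra.Properties.CommutativeSemigroup
  (CommutativeMonoid.commutativeSemigroup ℚ.+-0-commutativeMonoid)
  using (interchange)

private
  variable
    n m n′ m′ k : ℕ
    s : Slope

ΣFin-cong : ∀ k {f g : Fin k → ℚ} → (∀ i → f i ≡ g i) → ΣFin k f ≡ ΣFin k g
ΣFin-cong zero    f≗g = refl
ΣFin-cong (suc k) f≗g = cong₂ _+_ (f≗g zero) (ΣFin-cong k (f≗g ∘ suc))

ΣFin-zero : ∀ k {f : Fin k → ℚ} → (∀ i → f i ≡ 0ℚ) → ΣFin k f ≡ 0ℚ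
ΣFin-zero zero    f≗0 = refl
ΣFin-zero (suc k) f≗0 =
  trans (cong₂ _+_ (f≗0 zero) (ΣFin-zero k (f≗0 ∘ suc))) (ℚ.+-identityˡ 0ℚ)

ΣFin-sub : ∀ k (f g : Fin k → ℚ) →
           ΣFin k (λ i → f i - g i) ≡ ΣFin k f - ΣFin k g
ΣFin-sub zero    f g = sym (ℚ.+-inverseʳ 0ℚ)
ΣFin-sub (suc k) f g = begin
  (f zero - g zero) + ΣFin k (λ i → f (suc i) - g (suc i))
    ≡⟨ cong ((f zero - g zero) +_) (ΣFin-sub k (f ∘ suc) (g ∘ suc)) ⟩
  (f zero - g zero) + (F - G)
    ≡⟨ interchange (f zero) (ℚ.- g zero) F (ℚ.- G) ⟩
  (f zero + F) + (ℚ.- g zero + ℚ.- G)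
    ≡⟨ cong ((f zero + F) +_) (ℚ.neg-distrib-+ (g zero) G) ⟨
  (f zero + F) - (g zero + G) ∎
  where
  open ≡-Reasoning
  F = ΣFin k (f ∘ suc)
  G = ΣFin k (g ∘ suc)

ΣFin-dropHead : ∀ k (f : Fin (suc k) → ℚ) → f zero ≡ 0ℚ →
                ΣFin (suc k) f ≡ ΣFin k (f ∘ suc)
ΣFin-dropHead k f f0≡0 =
  trans (cong (_+ ΣFin k (f ∘ suc)) f0≡0) (ℚ.+-identityˡ (ΣFin k (f ∘ suc)))

ΣFin-dropLast : ∀ k (f : Fin (suc k) → ℚ) → f (fromℕ k) ≡ 0ℚ →
                ΣFin (suc k) f ≡ ΣFin k (f ∘ inject₁)
ΣFin-dropLast zero    f fk≡0 = trans (cong (_+ 0ℚ) fk≡0) (ℚ.+-identityˡ 0ℚ)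
ΣFin-dropLast (suc k) f fk≡0 = cong (f zero +_) (ΣFin-dropLast k (f ∘ suc) fk≡0)

infixl 5 _∷ʳ_

_∷ʳ_ : ∀ {a} {A : Set a} → Vector A k → A → Vector A (suc k)
_∷ʳ_ {k = zero}  xs x = x ∷ xs
_∷ʳ_ {k = suc k} xs x = head xs ∷ (tail xs ∷ʳ x)

∷ʳ-inject₁ : ∀ {a} {A : Set a} (xs : Vector A k) x i → (xs ∷ʳ x) (inject₁ i) ≡ xs i
∷ʳ-inject₁ {k = suc k} xs x zero    = refl
∷ʳ-inject₁ {k = suc k} xs x (suc i) = ∷ʳ-inject₁ (tail xs) x i

∷ʳ-last : ∀ {a} {A : Set a} (xs : Vector A k) x → (xs ∷ʳ x) (fromℕ k) ≡ x
∷ʳ-last {k = zero}  xs x = refl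
∷ʳ-last {k = suc k} xs x = ∷ʳ-last (tail xs) x

label-def : ∀ t (i : Fin n) (j : Fin m) →
            label t i j ≡ proj₂ (dir t) ℤ.* coord i ℤ.- proj₁ (dir t) ℤ.* coord j
label-def t i j with dir t
... | (a , b) = refl

label-cong : ∀ t {i : Fin n} {i′ : Fin n′} {j : Fin m} {j′ : Fin m′} →
             toℕ i ≡ toℕ i′ → toℕ j ≡ toℕ j′ → label t i j ≡ label t i′ j′
label-cong t {i} {i′} {j} {j′} i≡i′ j≡j′ = begin
  label t i j   ≡⟨ label-def t i j ⟩
  b ℤ.* ℤ.+ suc (toℕ i) ℤ.- a ℤ.* ℤ.+ suc (toℕ j)
                ≡⟨ cong₂ (λ x y → b ℤ.* ℤ.+ suc x ℤ.- a ℤ.* ℤ.+ suc y) i≡i′ j≡j′ ⟩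
  b ℤ.* ℤ.+ suc (toℕ i′) ℤ.- a ℤ.* ℤ.+ suc (toℕ j′)
                ≡⟨ label-def t i′ j′ ⟨
  label t i′ j′ ∎
  where
  open ≡-Reasoning
  a = proj₁ (dir t)
  b = proj₂ (dir t)

label-suc-col : ∀ t (i : Fin n) (j : Fin m) →
                label t (suc i) j ≡ label t i j ℤ.+ proj₂ (dir t)
label-suc-col t i j = begin
  label t (suc i) j                          ≡⟨ label-def t (suc i) j ⟩
  b ℤ.* (1ℤ ℤ.+ coord i) ℤ.- a ℤ.* coord j  ≡⟨ shift a b (coord i) (coord j) ⟩
  (b ℤ.* coord i ℤ.- a ℤ.* coord j) ℤ.+ b    ≡⟨ cong (ℤ._+ b) (label-def t i j) ⟨
  label t i j ℤ.+ b                          ∎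
  where
  open ≡-Reasoning
  a = proj₁ (dir t)
  b = proj₂ (dir t)
  shift : ∀ a b x y → b ℤ.* (1ℤ ℤ.+ x) ℤ.- a ℤ.* y ≡ (b ℤ.* x ℤ.- a ℤ.* y) ℤ.+ b
  shift = solve-∀

label-suc-row : ∀ t (i : Fin n) (j : Fin m) →
                label t i (suc j) ≡ label t i j ℤ.+ ℤ.- proj₁ (dir t)
label-suc-row t i j = begin
  label t i (suc j)                          ≡⟨ label-def t i (suc j) ⟩
  b ℤ.* coord i ℤ.- a ℤ.* (1ℤ ℤ.+ coord j)  ≡⟨ shift a b (coord i) (coord j) ⟩
  (b ℤ.* coord i ℤ.- a ℤ.* coord j) ℤ.- a    ≡⟨ cong (ℤ._- a) (label-def t i j) ⟨
  label t i j ℤ.- a                          ∎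
  where
  open ≡-Reasoning
  a = proj₁ (dir t)
  b = proj₂ (dir t)
  shift : ∀ a b x y → b ℤ.* x ℤ.- a ℤ.* (1ℤ ℤ.+ y) ≡ (b ℤ.* x ℤ.- a ℤ.* y) ℤ.- a
  shift = solve-∀

does-≟-shift : ∀ x δ ℓ → does (x ℤ.+ δ ℤ.≟ ℓ) ≡ does (x ℤ.≟ ℓ ℤ.- δ)
does-≟-shift x δ ℓ = does-⇔ (mk⇔ to from) (x ℤ.+ δ ℤ.≟ ℓ) (x ℤ.≟ ℓ ℤ.- δ)
  where
  to : x ℤ.+ δ ≡ ℓ → x ≡ ℓ ℤ.- δ
  to x+δ≡ℓ = trans (sym (//-rightDividesʳ δ x)) (cong (ℤ._- δ) x+δ≡ℓ)
  from : x ≡ ℓ ℤ.- δ → x ℤ.+ δ ≡ ℓ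
  from x≡ℓ-δ = trans (cong (ℤ._+ δ) x≡ℓ-δ) (//-rightDividesˡ δ ℓ)

select : Bool → ℚ → ℚ
select b x = if b then x else 0ℚ

select-zero : ∀ b → select b 0ℚ ≡ 0ℚ
select-zero true  = refl
select-zero false = refl

select-sub : ∀ b x y → select b (x - y) ≡ select b x - select b y
select-sub true  x y = refl
select-sub false x y = sym (ℚ.+-inverseʳ 0ℚ)

onLine : Slope → ℤ → Grid n m → Grid n m
onLine t ℓ X i j = select (does (label t i j ℤ.≟ ℓ)) (X i j)

onLine-cong : ∀ (X : Grid n m) (Y : Grid n′ m′) t ℓ {i j i′ j′} →
              label t i j ≡ label t i′ j′ → X i j ≡ Y i′ j′ →
              onLine t ℓ X i j ≡ onLine t ℓ Y i′ j′
onLine-cong X Y t ℓ ij≡i′j′ X≡Y =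
  cong₂ (λ l x → select (does (l ℤ.≟ ℓ)) x) ij≡i′j′ X≡Y

onLine-shift : ∀ (X : Grid n m) (Y : Grid n′ m′) t ℓ δ {i j i′ j′} →
               label t i j ≡ label t i′ j′ ℤ.+ δ → X i j ≡ Y i′ j′ →
               onLine t ℓ X i j ≡ onLine t (ℓ ℤ.- δ) Y i′ j′
onLine-shift X Y t ℓ δ {i′ = i′} {j′} ij≡i′j′+δ X≡Y = cong₂ select
  (trans (cong (λ l → does (l ℤ.≟ ℓ)) ij≡i′j′+δ) (does-≟-shift (label t i′ j′) δ ℓ))
  X≡Y

infixl 6 _⊖_

_⊖_ : Grid n m → Grid n m → Grid n m
(X ⊖ Y) i j = X i j - Y i j

zeroGrid : Grid n m
zeroGrid i j = 0ℚ

lineSum-⊖ : ∀ (X Y : Grid n m) t ℓ →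
            lineSum (X ⊖ Y) t ℓ ≡ lineSum X t ℓ - lineSum Y t ℓ
lineSum-⊖ {n} {m} X Y t ℓ =
  trans (ΣFin-cong n λ i → trans (ΣFin-cong m λ j → select-sub _ (X i j) (Y i j))
                                 (ΣFin-sub m _ _))
        (ΣFin-sub n _ _)

lineSum-miss : ∀ (X : Grid n m) t ℓ → (∀ i j → label t i j ≢ ℓ) → lineSum X t ℓ ≡ 0ℚ
lineSum-miss {n} {m} X t ℓ miss = ΣFin-zero n λ i → ΣFin-zero m λ j →
  cong (λ b → select b (X i j)) (dec-false (label t i j ℤ.≟ ℓ) (miss i j))

appendCol : Grid n m → Grid (suc n) m
appendCol D = D ∷ʳ λ _ → 0ℚ

prependCol : Grid n m → Grid (suc n) m
prependCol D = (λ _ → 0ℚ) ∷ D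

appendRow : Grid n m → Grid n (suc m)
appendRow D i = D i ∷ʳ 0ℚ

prependRow : Grid n m → Grid n (suc m)
prependRow D i = 0ℚ ∷ D i

lineSum-appendCol : ∀ (D : Grid n m) t ℓ → lineSum (appendCol D) t ℓ ≡ lineSum D t ℓ
lineSum-appendCol {n} {m} D t ℓ = begin
  ΣFin (suc n) (λ i → ΣFin m (onLine t ℓ D′ i))
    ≡⟨ ΣFin-dropLast n (λ i → ΣFin m (onLine t ℓ D′ i)) (ΣFin-zero m λ j →
         trans (cong (select _) (cong-app (∷ʳ-last D _) j)) (select-zero _)) ⟩
  ΣFin n (λ i → ΣFin m (onLine t ℓ D′ (inject₁ i)))
    ≡⟨ ΣFin-cong n (λ i → ΣFin-cong m λ j → onLine-cong D′ D t ℓ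
         (label-cong t (toℕ-inject₁ i) refl) (cong-app (∷ʳ-inject₁ D _ i) j)) ⟩
  lineSum D t ℓ ∎
  where
  open ≡-Reasoning
  D′ = appendCol D

lineSum-prependCol : ∀ (D : Grid n m) t ℓ →
                     lineSum (prependCol D) t ℓ ≡ lineSum D t (ℓ ℤ.- proj₂ (dir t))
lineSum-prependCol {n} {m} D t ℓ = begin
  ΣFin (suc n) (λ i → ΣFin m (onLine t ℓ D′ i))
    ≡⟨ ΣFin-dropHead n (λ i → ΣFin m (onLine t ℓ D′ i))
         (ΣFin-zero m λ j → select-zero _) ⟩
  ΣFin n (λ i → ΣFin m (onLine t ℓ D′ (suc i)))
    ≡⟨ ΣFin-cong n (λ i → ΣFin-cong m λ j → onLine-shift D′ D t ℓ (proj₂ (dir t))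
         (label-suc-col t i j) refl) ⟩
  lineSum D t (ℓ ℤ.- proj₂ (dir t)) ∎
  where
  open ≡-Reasoning
  D′ = prependCol D

lineSum-appendRow : ∀ (D : Grid n m) t ℓ → lineSum (appendRow D) t ℓ ≡ lineSum D t ℓ
lineSum-appendRow {n} {m} D t ℓ = ΣFin-cong n λ i → begin
  ΣFin (suc m) (onLine t ℓ D′ i)
    ≡⟨ ΣFin-dropLast m (onLine t ℓ D′ i)
         (trans (cong (select _) (∷ʳ-last (D i) 0ℚ)) (select-zero _)) ⟩
  ΣFin m (λ j → onLine t ℓ D′ i (inject₁ j))
    ≡⟨ ΣFin-cong m (λ j → onLine-cong D′ D t ℓ
         (label-cong t refl (toℕ-inject₁ j)) (∷ʳ-inject₁ (D i) 0ℚ j)) ⟩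
  ΣFin m (onLine t ℓ D i) ∎
  where
  open ≡-Reasoning
  D′ = appendRow D

lineSum-prependRow : ∀ (D : Grid n m) t ℓ →
                     lineSum (prependRow D) t ℓ ≡ lineSum D t (ℓ ℤ.- ℤ.- proj₁ (dir t))
lineSum-prependRow {n} {m} D t ℓ = ΣFin-cong n λ i → begin
  ΣFin (suc m) (onLine t ℓ D′ i)
    ≡⟨ ΣFin-dropHead m (onLine t ℓ D′ i) (select-zero _) ⟩
  ΣFin m (λ j → onLine t ℓ D′ i (suc j))
    ≡⟨ ΣFin-cong m (λ j → onLine-shift D′ D t ℓ (ℤ.- proj₁ (dir t))
         (label-suc-row t i j) refl) ⟩
  ΣFin m (onLine t (ℓ ℤ.- ℤ.- proj₁ (dir t)) D i) ∎
  where
  open ≡-Reasoning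
  D′ = prependRow D

Homogeneous : ∀ n m → Slope → Grid n m → Set
Homogeneous n m s D = ∀ t → t ⪯ s → ∀ ℓ → lineSum D t ℓ ≡ 0ℚ

zeroConstants : Constants
zeroConstants t ℓ = 0ℚ

homogeneous⇒solution : ∀ {D} → Homogeneous n m s D → IsSolution n m s zeroConstants D
homogeneous⇒solution hom t t⪯s i j = hom t t⪯s (label t i j)

zeroGrid-homogeneous : Homogeneous n m s zeroGrid
zeroGrid-homogeneous {n} {m} t t⪯s ℓ =
  ΣFin-zero n λ i → ΣFin-zero m λ j → select-zero _

zeroConstants-solvable : Solvable n m s zeroConstants
zeroConstants-solvable {n} {m} =
  zeroGrid , homogeneous⇒solution (zeroGrid-homogeneous {n} {m})

⊖-homogeneous : ∀ {c} {X Y : Grid n m} → IsSolution n m s c X → IsSolution n m s c Y →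
                Homogeneous n m s (X ⊖ Y)
⊖-homogeneous {n} {m} {c = c} {X} {Y} X-sol Y-sol t t⪯s ℓ
  with any? (λ i → any? λ j → label t i j ℤ.≟ ℓ)
... | no miss = lineSum-miss (X ⊖ Y) t ℓ λ i j ij∈ℓ → miss (i , j , ij∈ℓ)
... | yes (i , j , refl) = begin
  lineSum (X ⊖ Y) t ℓ             ≡⟨ lineSum-⊖ X Y t ℓ ⟩
  lineSum X t ℓ - lineSum Y t ℓ   ≡⟨ cong₂ _-_ (X-sol t t⪯s i j) (Y-sol t t⪯s i j) ⟩
  c t ℓ - c t ℓ                   ≡⟨ ℚ.+-inverseʳ (c t ℓ) ⟩
  0ℚ                              ∎
  where open ≡-Reasoning

UniqueOn : ∀ n m → Slope → Constants → (Fin n → Fin m → Set) → Set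
UniqueOn n m s c P = ∀ X Y → IsSolution n m s c X → IsSolution n m s c Y →
                     ∀ i j → P i j → X i j ≡ Y i j

VanishesOn : ∀ n m → Slope → (Fin n → Fin m → Set) → Set
VanishesOn n m s P = ∀ D → Homogeneous n m s D → ∀ i j → P i j → D i j ≡ 0ℚ

uniqueOn⇒vanishesOn : ∀ {P} → UniqueOn n m s zeroConstants P → VanishesOn n m s P
uniqueOn⇒vanishesOn {n} {m} unique D hom = unique D zeroGrid
  (homogeneous⇒solution hom) (homogeneous⇒solution (zeroGrid-homogeneous {n} {m}))

vanishesOn⇒uniqueOn : ∀ {P c} → VanishesOn n m s P → UniqueOn n m s c P
vanishesOn⇒uniqueOn {c = c} vanishes X Y X-sol Y-sol i j Pij =
  x∙y⁻¹≈ε⇒x≈y (X i j) (Y i j) (vanishes (X ⊖ Y) (⊖-homogeneous {c = c} X-sol Y-sol) i j Pij)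

record Padding (n m n′ m′ : ℕ) : Set where
  field
    pad         : Grid n m → Grid n′ m′
    col         : Fin n → Fin n′
    row         : Fin m → Fin m′
    pad-agrees  : ∀ D i j → pad D (col i) (row j) ≡ D i j
    lineSum-pad : ∀ D t ℓ → ∃ λ ℓ′ → lineSum (pad D) t ℓ ≡ lineSum D t ℓ′

  pad-homogeneous : ∀ {D} → Homogeneous n m s D → Homogeneous n′ m′ s (pad D)
  pad-homogeneous {D = D} hom t t⪯s ℓ with lineSum-pad D t ℓ
  ... | ℓ′ , pad≡D = trans pad≡D (hom t t⪯s ℓ′)

  vanishesOn-restrict : ∀ {P Q} → (∀ i j → Q i j → P (col i) (row j)) →
                        VanishesOn n′ m′ s P → VanishesOn n m s Q
  vanishesOn-restrict Q⇒P vanishes D hom i j Qij =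
    trans (sym (pad-agrees D i j)) (vanishes (pad D) (pad-homogeneous hom) _ _ (Q⇒P i j Qij))

  uniqueOn-restrict : ∀ {P Q c} → (∀ i j → Q i j → P (col i) (row j)) →
                      UniqueOn n′ m′ s zeroConstants P → UniqueOn n m s c Q
  uniqueOn-restrict {c = c} Q⇒P = vanishesOn⇒uniqueOn {c = c}
    ∘ vanishesOn-restrict Q⇒P ∘ uniqueOn⇒vanishesOn

padAppendCol : Padding n m (suc n) m
padAppendCol = record
  { pad         = appendCol
  ; col         = inject₁
  ; row         = id
  ; pad-agrees  = λ D i → cong-app (∷ʳ-inject₁ D _ i)
  ; lineSum-pad = λ D t ℓ → ℓ , lineSum-appendCol D t ℓ
  }

padPrependCol : Padding n m (suc n) m
padPrependCol = record
  { pad         = prependCol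
  ; col         = suc
  ; row         = id
  ; pad-agrees  = λ D i j → refl
  ; lineSum-pad = λ D t ℓ → _ , lineSum-prependCol D t ℓ
  }

padAppendRow : Padding n m n (suc m)
padAppendRow = record
  { pad         = appendRow
  ; col         = id
  ; row         = inject₁
  ; pad-agrees  = λ D i → ∷ʳ-inject₁ (D i) 0ℚ
  ; lineSum-pad = λ D t ℓ → ℓ , lineSum-appendRow D t ℓ
  }

padPrependRow : Padding n m n (suc m)
padPrependRow = record
  { pad         = prependRow
  ; col         = id
  ; row         = suc
  ; pad-agrees  = λ D i j → refl
  ; lineSum-pad = λ D t ℓ → _ , lineSum-prependRow D t ℓ
  }

rowProp-shrinkWidth : ∀ {t} → RowProp (suc n) m t → RowProp n m t
rowProp-shrinkWidth rowProp c _ =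
  Sum.map (Padding.uniqueOn-restrict padAppendCol {c = c} λ _ _ → id)
          (Padding.uniqueOn-restrict padAppendCol {c = c} λ _ _ → id)
          (rowProp zeroConstants zeroConstants-solvable)

rowProp-shrinkHeight : ∀ {t} → RowProp n (suc m) t → RowProp n m t
rowProp-shrinkHeight {m = zero}  _       _ _ = inj₁ λ _ _ _ _ _ ()
rowProp-shrinkHeight {m = suc m} rowProp c _ =
  Sum.map (Padding.uniqueOn-restrict padAppendRow {c = c} λ _ j → trans (toℕ-inject₁ j))
          (Padding.uniqueOn-restrict padPrependRow {c = c} λ _ _ → cong suc)
          (rowProp zeroConstants zeroConstants-solvable)

colProp-shrinkWidth : ∀ {t} → ColProp (suc n) m t → ColProp n m t
colProp-shrinkWidth {n = zero}  _       _ _ = inj₁ λ _ _ _ _ ()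
colProp-shrinkWidth {n = suc n} colProp c _ =
  Sum.map (Padding.uniqueOn-restrict padAppendCol {c = c} λ i _ → trans (toℕ-inject₁ i))
          (Padding.uniqueOn-restrict padPrependCol {c = c} λ _ _ → cong suc)
          (colProp zeroConstants zeroConstants-solvable)

colProp-shrinkHeight : ∀ {t} → ColProp n (suc m) t → ColProp n m t
colProp-shrinkHeight colProp c _ =
  Sum.map (Padding.uniqueOn-restrict padAppendRow {c = c} λ _ _ → id)
          (Padding.uniqueOn-restrict padAppendRow {c = c} λ _ _ → id)
          (colProp zeroConstants zeroConstants-solvable)

IsLeast : (Slope → Set) → Slope → Set
IsLeast P r = P r × (∀ t → P t → r ⪯ t)

IsLeast-mono : ∀ {P Q r r′} → Q ⊆ P → IsLeast P r → IsLeast Q r′ → r ⪯ r′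
IsLeast-mono Q⊆P (_ , r-least) (Qr′ , _) = r-least _ (Q⊆P Qr′)

IsMinOfLeast : (Slope → Set) → (Slope → Set) → Slope → Set
IsMinOfLeast P Q s = ∃ λ r → ∃ λ c → IsLeast P r × IsLeast Q c × s ≡ r ⊓ c

IsMinOfLeast-mono : ∀ {P P′ Q Q′ s s′} → P′ ⊆ P → Q′ ⊆ Q →
                    IsMinOfLeast P Q s → IsMinOfLeast P′ Q′ s′ → s ⪯ s′
IsMinOfLeast-mono P′⊆P Q′⊆Q (_ , _ , R , C , refl) (_ , _ , R′ , C′ , refl) =
  ⊓-mono-≤ (IsLeast-mono P′⊆P R R′) (IsLeast-mono Q′⊆Q C C′)

proposition4 : ∀ (n m : ℕ) → 1 ≤ n → 1 ≤ m →
    ((∀ r r′ → IsR n m r → IsR (suc n) m r′ → r ⪯ r′) ×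
     (∀ r r′ → IsR n m r → IsR n (suc m) r′ → r ⪯ r′)) ×
    ((∀ c c′ → IsC n m c → IsC (suc n) m c′ → c ⪯ c′) ×
     (∀ c c′ → IsC n m c → IsC n (suc m) c′ → c ⪯ c′)) ×
    ((∀ s s′ → IsS n m s → IsS (suc n) m s′ → s ⪯ s′) ×
     (∀ s s′ → IsS n m s → IsS n (suc m) s′ → s ⪯ s′))
proposition4 n m _ _ =
    ( (λ _ _ → IsLeast-mono rowProp-shrinkWidth)
    , (λ _ _ → IsLeast-mono rowProp-shrinkHeight) )
  , ( (λ _ _ → IsLeast-mono colProp-shrinkWidth)
    , (λ _ _ → IsLeast-mono colProp-shrinkHeight) )
  , ( (λ _ _ → IsMinOfLeast-mono rowProp-shrinkWidth colProp-shrinkWidth)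
    , (λ _ _ → IsMinOfLeast-mono rowProp-shrinkHeight colProp-shrinkHeight) )
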